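{- Let $G$ be a connected $P_5$-free chordal bipartite graph with bipartition $(A,B)$, let $(A_1,B_1)$ be a maximum biclique of $G$ with $A_1\subseteq A$, $B_1\subseteq B$, and let $A_2=A\setminus A_1$, $B_2=B\setminus B_1$. For distinct $x,x'\in A_2$, if $d(x)\le d(x')$ then $N_G(x)\subseteq N_G(x')$. Similarly, for distinct $y,y'\in B_2$, if $d(y)\le d(y')$ then $N_G(y)\subseteq N_G(y')$.
   Context: Graphs are finite, simple and undirected. A bipartite graph is chordal bipartite if every cycle of length at least six has a chord. $G$ is $P_5$-free if it has no induced path on five vertices. $N_G(v)$ is the neighbourhood of $v$ and $d(v)=|N_G(v)|$. A biclique is a pair $(X,Y)$ with $X\subseteq A$, $Y\subseteq B$ such that every vertex of $X$ is adjacent to every vertex of $Y$; it is maximal if no vertex can be added to $X$ or to $Y$ keeping this property. Following the paper, a maximum biclique is a maximal biclique $(X,Y)$ for which $\bigl||X|-|Y|\bigr|$ is minimum. -}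

module Defs where

open import Data.Bool using (Bool; true; false)
open import Data.Nat using (ℕ; zero; suc; _≤_; _∸_; ∣_-_∣)
open import Data.Fin using (Fin; toℕ)
open import Data.Fin.Subset using (Subset; _∈_; _∉_; _⊆_; ∣_∣)
open import Data.Vec using (tabulate)
open import Data.Product using (Σ; _×_; ∃)
open import Data.Sum using (_⊎_)
open import Function using (_⇔_)
open import Function.Definitions using (Injective)
open import Relation.Binary.PropositionalEquality using (_≡_; _≢_)
open import Relation.Nullary using (¬_)

record Graph (n : ℕ) : Set where
  field
    adj     : Fin n → Fin n → Bool
    symm    : ∀ u v → adj u v ≡ adj v u
    irrefl  : ∀ v → adj v v ≡ false

module _ {n : ℕ} (G : Graph n) where
  open Graph G

  Edge : Fin n → Fin n → Set
  Edge u v = adj u v ≡ true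

  N : Fin n → Subset n
  N v = tabulate (adj v)

  deg : Fin n → ℕ
  deg v = ∣ N v ∣

  data Reach : Fin n → Fin n → Set where
    here : ∀ {u} → Reach u u
    step : ∀ {u v w} → Edge u v → Reach v w → Reach u w

  Connected : Set
  Connected = ∀ u v → Reach u v

  IsBipartition : Subset n → Set
  IsBipartition A = ∀ u v → Edge u v → (u ∈ A × v ∉ A) ⊎ (u ∉ A × v ∈ A)

  CycSucc : (k : ℕ) → Fin k → Fin k → Set
  CycSucc k i j = (toℕ j ≡ suc (toℕ i)) ⊎ (toℕ i ≡ k ∸ 1 × toℕ j ≡ 0)

  IsCycle : (k : ℕ) → (Fin k → Fin n) → Set
  IsCycle k c = Injective _≡_ _≡_ c × (∀ i j → CycSucc k i j → Edge (c i) (c j))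

  HasChord : (k : ℕ) → (Fin k → Fin n) → Set
  HasChord k c = Σ (Fin k) λ i → Σ (Fin k) λ j →
    i ≢ j × ¬ CycSucc k i j × ¬ CycSucc k j i × Edge (c i) (c j)

  ChordalBipartite : Subset n → Set
  ChordalBipartite A = IsBipartition A ×
    (∀ k → 6 ≤ k → (c : Fin k → Fin n) → IsCycle k c → HasChord k c)

  IsInducedP5 : (Fin 5 → Fin n) → Set
  IsInducedP5 p = Injective _≡_ _≡_ p ×
    (∀ i j → Edge (p i) (p j) ⇔ ((toℕ j ≡ suc (toℕ i)) ⊎ (toℕ i ≡ suc (toℕ j))))

  P5Free : Set
  P5Free = ∀ p → ¬ IsInducedP5 p

  IsBiclique : Subset n → Subset n → Subset n → Set
  IsBiclique A X Y = (∀ x → x ∈ X → x ∈ A) × (∀ y → y ∈ Y → y ∉ A) ×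
    (∀ x y → x ∈ X → y ∈ Y → Edge x y)

  IsMaximalBiclique : Subset n → Subset n → Subset n → Set
  IsMaximalBiclique A X Y = IsBiclique A X Y ×
    (∀ a → a ∈ A → a ∉ X → ¬ (∀ y → y ∈ Y → Edge a y)) ×
    (∀ b → b ∉ A → b ∉ Y → ¬ (∀ x → x ∈ X → Edge x b))

  -- maximum (in the paper's sense): maximal, minimising ||X| - |Y||
  IsMaximumBiclique : Subset n → Subset n → Subset n → Set
  IsMaximumBiclique A X Y = IsMaximalBiclique A X Y ×
    (∀ X' Y' → IsMaximalBiclique A X' Y' → ∣ ∣ X ∣ - ∣ Y ∣ ∣ ≤ ∣ ∣ X' ∣ - ∣ Y' ∣ ∣)

-- Indeed two same-side vertices with incomparable neighbourhoods give an induced 2K₂, and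
-- following a walk from one edge of it to the other, the first vertex adjacent to the far
-- edge closes an induced P₅. Nestedness plus the degree inequality forces the inclusion.
module Submission where

open import Defs
open import Data.Nat using (ℕ; _≤_; suc)
open import Data.Nat.Properties using (<⇒≱) renaming (_≟_ to _≟ℕ_)
open import Data.Bool using (true)
open import Data.Bool.Properties using () renaming (_≟_ to _≟𝔹_)
open import Data.Fin using (Fin; toℕ; _≟_)
open import Data.Fin.Patterns using (0F; 1F; 2F; 3F; 4F)
open import Data.Fin.Properties using (all?; any?)
open import Data.Fin.Subset using (Subset; _∈_; _∉_; _⊆_)
open import Data.Fin.Subset.Properties using (p⊂q⇒∣p∣<∣q∣)
open import Data.Vec.Properties using ([]=⇒lookup; lookup⇒[]=; lookup∘tabulate)
open import Data.Product using (_×_; _,_)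
open import Data.Sum using (_⊎_; inj₁; inj₂; swap)
open import Data.Empty using (⊥-elim)
open import Function using (_⇔_; mk⇔; Equivalence)
open import Function.Definitions using (Injective)
open import Relation.Nullary using (¬_; yes; no)
open import Relation.Nullary.Decidable
  using (Dec; True; False; from-yes; toWitness; toWitnessFalse; _×-dec_; _⊎-dec_; _→-dec_; ¬?)
open import Relation.Binary.PropositionalEquality using (_≡_; _≢_; refl; sym; trans; subst)

PathAdjacent : Fin 5 → Fin 5 → Set
PathAdjacent i j = (toℕ j ≡ suc (toℕ i)) ⊎ (toℕ i ≡ suc (toℕ j))

pathAdjacent? : ∀ i j → Dec (PathAdjacent i j)
pathAdjacent? i j = (toℕ j ≟ℕ suc (toℕ i)) ⊎-dec (toℕ i ≟ℕ suc (toℕ j))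

PathTwins : Fin 5 → Fin 5 → Set
PathTwins i j = ∀ k → (PathAdjacent i k → PathAdjacent j k) × (PathAdjacent j k → PathAdjacent i k)

pathTwins? : ∀ i j → Dec (PathTwins i j)
pathTwins? i j =
  all? λ k → (pathAdjacent? i k →-dec pathAdjacent? j k) ×-dec (pathAdjacent? j k →-dec pathAdjacent? i k)

P₅-twinFree : ∀ i j → ¬ PathAdjacent i j → PathTwins i j → i ≡ j
P₅-twinFree = from-yes (all? λ i → all? λ j → ¬? (pathAdjacent? i j) →-dec (pathTwins? i j →-dec (i ≟ j)))

module _ {n : ℕ} (G : Graph n) where
  open Graph G

  Edge-sym : ∀ {u v} → Edge G u v → Edge G v u
  Edge-sym {u} {v} e = trans (symm v u) e

  Edge-irrefl : ∀ u → ¬ Edge G u u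
  Edge-irrefl u e with trans (sym e) (irrefl u)
  ... | ()

  ∈N⇒Edge : ∀ {x y} → y ∈ N G x → Edge G x y
  ∈N⇒Edge {x} {y} y∈ = trans (sym (lookup∘tabulate (adj x) y)) ([]=⇒lookup y∈)

  Edge⇒∈N : ∀ {x y} → Edge G x y → y ∈ N G x
  Edge⇒∈N {x} {y} e = lookup⇒[]= y (N G x) (trans (lookup∘tabulate (adj x) y) e)

  -- In a bipartite graph with a and a′ on the same side this is an induced 2K₂.
  record Induced2K₂ (a b a′ b′ : Fin n) : Set where
    field
      edge  : Edge G a b
      edge′ : Edge G a′ b′
      gap   : ¬ Edge G a b′
      gap′  : ¬ Edge G a′ b

  ⊆-of-no2K₂ : ∀ x x′ → (∀ y y′ → ¬ Induced2K₂ x y x′ y′) → deg G x ≤ deg G x′ → N G x ⊆ N G x′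
  ⊆-of-no2K₂ x x′ no2K₂ d {y} y∈ with adj x′ y ≟𝔹 true
  ... | yes x′y = Edge⇒∈N x′y
  ... | no ¬x′y with any? (λ y′ → (adj x′ y′ ≟𝔹 true) ×-dec ¬? (adj x y′ ≟𝔹 true))
  ...   | yes (y′ , x′y′ , ¬xy′) = ⊥-elim (no2K₂ y y′ (record
            { edge = ∈N⇒Edge y∈ ; edge′ = x′y′ ; gap = ¬xy′ ; gap′ = ¬x′y }))
  ...   | no none = ⊥-elim (<⇒≱ (p⊂q⇒∣p∣<∣q∣ (N′⊆N , y , y∈ , λ y∈′ → ¬x′y (∈N⇒Edge y∈′))) d)
    where
    N′⊆N : N G x′ ⊆ N G x
    N′⊆N {z} z∈ with adj x z ≟𝔹 true
    ... | yes xz = Edge⇒∈N xz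
    ... | no ¬xz = ⊥-elim (none (z , ∈N⇒Edge z∈ , ¬xz))

  adjacency⇒injective : (p : Fin 5 → Fin n) → (∀ i j → Edge G (p i) (p j) ⇔ PathAdjacent i j) →
                        Injective _≡_ _≡_ p
  adjacency⇒injective p adj⇔ {i} {j} pi≡pj = P₅-twinFree i j apart sameNeighbours
    where
    open Equivalence
    apart : ¬ PathAdjacent i j
    apart ij = Edge-irrefl (p j) (subst (λ u → Edge G u (p j)) pi≡pj (from (adj⇔ i j) ij))
    sameNeighbours : PathTwins i j
    sameNeighbours k = (λ ik → to (adj⇔ j k) (subst (λ u → Edge G u (p k)) pi≡pj (from (adj⇔ i k) ik)))
                     , (λ jk → to (adj⇔ i k) (subst (λ u → Edge G u (p k)) (sym pi≡pj) (from (adj⇔ j k) jk)))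

  path₅ : (v₀ v₁ v₂ v₃ v₄ : Fin n) → Fin 5 → Fin n
  path₅ v₀ v₁ v₂ v₃ v₄ 0F = v₀
  path₅ v₀ v₁ v₂ v₃ v₄ 1F = v₁
  path₅ v₀ v₁ v₂ v₃ v₄ 2F = v₂
  path₅ v₀ v₁ v₂ v₃ v₄ 3F = v₃
  path₅ v₀ v₁ v₂ v₃ v₄ 4F = v₄

  isInducedP5-path₅ : ∀ {v₀ v₁ v₂ v₃ v₄} →
    Edge G v₀ v₁ → Edge G v₁ v₂ → Edge G v₂ v₃ → Edge G v₃ v₄ →
    ¬ Edge G v₀ v₂ → ¬ Edge G v₀ v₃ → ¬ Edge G v₀ v₄ →
    ¬ Edge G v₁ v₃ → ¬ Edge G v₁ v₄ → ¬ Edge G v₂ v₄ →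
    IsInducedP5 G (path₅ v₀ v₁ v₂ v₃ v₄)
  isInducedP5-path₅ {v₀} {v₁} {v₂} {v₃} {v₄} e₀₁ e₁₂ e₂₃ e₃₄ n₀₂ n₀₃ n₀₄ n₁₃ n₁₄ n₂₄ =
    adjacency⇒injective p adj⇔ , adj⇔
    where
    p : Fin 5 → Fin n
    p = path₅ v₀ v₁ v₂ v₃ v₄
    adjacent : ∀ {i j} → Edge G (p i) (p j) → {True (pathAdjacent? i j)} →
               Edge G (p i) (p j) ⇔ PathAdjacent i j
    adjacent e {ij} = mk⇔ (λ _ → toWitness ij) (λ _ → e)
    apart : ∀ {i j} → ¬ Edge G (p i) (p j) → {False (pathAdjacent? i j)} →
            Edge G (p i) (p j) ⇔ PathAdjacent i j
    apart ¬e {¬ij} = mk⇔ (λ e → ⊥-elim (¬e e)) (λ ij → ⊥-elim (toWitnessFalse ¬ij ij))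
    flip : ∀ {u v} → ¬ Edge G u v → ¬ Edge G v u
    flip ¬e e = ¬e (Edge-sym e)
    adj⇔ : ∀ i j → Edge G (p i) (p j) ⇔ PathAdjacent i j
    adj⇔ 0F 0F = apart (Edge-irrefl v₀)
    adj⇔ 0F 1F = adjacent e₀₁
    adj⇔ 0F 2F = apart n₀₂
    adj⇔ 0F 3F = apart n₀₃
    adj⇔ 0F 4F = apart n₀₄
    adj⇔ 1F 0F = adjacent (Edge-sym e₀₁)
    adj⇔ 1F 1F = apart (Edge-irrefl v₁)
    adj⇔ 1F 2F = adjacent e₁₂
    adj⇔ 1F 3F = apart n₁₃
    adj⇔ 1F 4F = apart n₁₄
    adj⇔ 2F 0F = apart (flip n₀₂)
    adj⇔ 2F 1F = adjacent (Edge-sym e₁₂)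
    adj⇔ 2F 2F = apart (Edge-irrefl v₂)
    adj⇔ 2F 3F = adjacent e₂₃
    adj⇔ 2F 4F = apart n₂₄
    adj⇔ 3F 0F = apart (flip n₀₃)
    adj⇔ 3F 1F = apart (flip n₁₃)
    adj⇔ 3F 2F = adjacent (Edge-sym e₂₃)
    adj⇔ 3F 3F = apart (Edge-irrefl v₃)
    adj⇔ 3F 4F = adjacent e₃₄
    adj⇔ 4F 0F = apart (flip n₀₄)
    adj⇔ 4F 1F = apart (flip n₁₄)
    adj⇔ 4F 2F = apart (flip n₂₄)
    adj⇔ 4F 3F = adjacent (Edge-sym e₃₄)
    adj⇔ 4F 4F = apart (Edge-irrefl v₄)

module Bipartite {n : ℕ} (G : Graph n) (A : Subset n) (bip : IsBipartition G A) where
  open Graph G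

  SameSide : Fin n → Fin n → Set
  SameSide u v = (u ∈ A × v ∈ A) ⊎ (u ∉ A × v ∉ A)

  SameSide-sym : ∀ {u v} → SameSide u v → SameSide v u
  SameSide-sym (inj₁ (u∈ , v∈)) = inj₁ (v∈ , u∈)
  SameSide-sym (inj₂ (u∉ , v∉)) = inj₂ (v∉ , u∉)

  SameSide⇒¬Edge : ∀ {u v} → SameSide u v → ¬ Edge G u v
  SameSide⇒¬Edge {u} {v} s e with bip u v e | s
  ... | inj₁ (_ , v∉) | inj₁ (_ , v∈) = v∉ v∈
  ... | inj₁ (u∈ , _) | inj₂ (u∉ , _) = u∉ u∈
  ... | inj₂ (u∉ , _) | inj₁ (u∈ , _) = u∉ u∈
  ... | inj₂ (_ , v∈) | inj₂ (_ , v∉) = v∉ v∈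

  Edge-∈⇒∉ : ∀ {u v} → Edge G u v → u ∈ A → v ∉ A
  Edge-∈⇒∉ {u} {v} e u∈ with bip u v e
  ... | inj₁ (_ , v∉) = v∉
  ... | inj₂ (u∉ , _) = ⊥-elim (u∉ u∈)

  Edge-∉⇒∈ : ∀ {u v} → Edge G u v → u ∉ A → v ∈ A
  Edge-∉⇒∈ {u} {v} e u∉ with bip u v e
  ... | inj₁ (u∈ , _) = ⊥-elim (u∉ u∈)
  ... | inj₂ (_ , v∈) = v∈

  SameSide-across : ∀ {u u′ w w′} → Edge G u u′ → Edge G w w′ → SameSide u w → SameSide u′ w′
  SameSide-across e e′ (inj₁ (u∈ , w∈)) = inj₂ (Edge-∈⇒∉ e u∈ , Edge-∈⇒∉ e′ w∈)
  SameSide-across e e′ (inj₂ (u∉ , w∉)) = inj₁ (Edge-∉⇒∈ e u∉ , Edge-∉⇒∈ e′ w∉)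

  SameSide-twoStep : ∀ {u v w} → Edge G u v → Edge G v w → SameSide u w
  SameSide-twoStep {u} {v} {w} e e′ with bip u v e
  ... | inj₁ (u∈ , v∉) = inj₁ (u∈ , Edge-∉⇒∈ e′ v∉)
  ... | inj₂ (u∉ , v∈) = inj₂ (u∉ , Edge-∈⇒∉ e′ v∈)

  bridged2K₂⇒¬P5Free : ∀ {a b a′ b′ v} → Induced2K₂ G a b a′ b′ → SameSide a a′ →
                       Edge G a v → Edge G v a′ → ¬ P5Free G
  bridged2K₂⇒¬P5Free {a} {b} {a′} {b′} {v} k aa′ av va′ p5Free =
    p5Free (path₅ G b a v a′ b′)
      (isInducedP5-path₅ G (Edge-sym G edge) av va′ edge′
        (SameSide⇒¬Edge (SameSide-twoStep (Edge-sym G edge) av))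
        (λ ba′ → gap′ (Edge-sym G ba′))
        (SameSide⇒¬Edge (SameSide-across edge edge′ aa′))
        (SameSide⇒¬Edge aa′)
        gap
        (SameSide⇒¬Edge (SameSide-twoStep va′ edge′)))
    where open Induced2K₂ k

  -- Walking from a towards the second edge, the first vertex adjacent to a′ closes an
  -- induced P₅ b a v a′ b′; otherwise the step to v yields the smaller 2K₂ (v a, b′ a′).
  walk⇒¬P5Free : ∀ {a b a′ b′ t} → Induced2K₂ G a b a′ b′ → SameSide a a′ →
                 t ≡ a′ ⊎ t ≡ b′ → Reach G a t → ¬ P5Free G
  walk⇒¬P5Free k aa′ (inj₁ refl) here _ = Induced2K₂.gap k (Induced2K₂.edge′ k)
  walk⇒¬P5Free k aa′ (inj₂ refl) here _ = SameSide⇒¬Edge (SameSide-sym aa′) (Induced2K₂.edge′ k)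
  walk⇒¬P5Free {a} {b} {a′} {b′} k aa′ end (step {v = v} av r) with adj v a′ ≟𝔹 true
  ... | yes va′ = bridged2K₂⇒¬P5Free k aa′ av va′
  ... | no ¬va′ = walk⇒¬P5Free k′ (SameSide-across av edge′ aa′) (swap end) r
    where
    open Induced2K₂ k
    k′ : Induced2K₂ G v a b′ a′
    k′ = record { edge = Edge-sym G av ; edge′ = Edge-sym G edge′ ; gap = ¬va′
                ; gap′ = λ b′a → gap (Edge-sym G b′a) }

  no2K₂ : Connected G → P5Free G → ∀ {a b a′ b′} → SameSide a a′ → ¬ Induced2K₂ G a b a′ b′
  no2K₂ connected p5Free {a} {a′ = a′} aa′ k = walk⇒¬P5Free k aa′ (inj₁ refl) (connected a a′) p5Free

  SameSide-deg≤⇒⊆ : Connected G → P5Free G → ∀ {x x′} → SameSide x x′ →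
                    deg G x ≤ deg G x′ → N G x ⊆ N G x′
  SameSide-deg≤⇒⊆ connected p5Free {x} {x′} xx′ =
    ⊆-of-no2K₂ G x x′ λ _ _ → no2K₂ connected p5Free xx′

lemma3 : ∀ {n : ℕ} (G : Graph n) (A A₁ B₁ : Subset n) →
    Connected G → P5Free G → ChordalBipartite G A →
    IsMaximumBiclique G A A₁ B₁ →
    (∀ x x′ → x ≢ x′ → x ∈ A → x ∉ A₁ → x′ ∈ A → x′ ∉ A₁ →
      deg G x ≤ deg G x′ → N G x ⊆ N G x′)
    ×
    (∀ y y′ → y ≢ y′ → y ∉ A → y ∉ B₁ → y′ ∉ A → y′ ∉ B₁ →
      deg G y ≤ deg G y′ → N G y ⊆ N G y′)
lemma3 G A A₁ B₁ connected p5Free (bipartite , _) _ =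
  (λ x x′ _ x∈ _ x′∈ _ → nested (inj₁ (x∈ , x′∈))) ,
  (λ y y′ _ y∉ _ y′∉ _ → nested (inj₂ (y∉ , y′∉)))
  where
  open Bipartite G A bipartite
  nested : ∀ {x x′} → SameSide x x′ → deg G x ≤ deg G x′ → N G x ⊆ N G x′
  nested = SameSide-deg≤⇒⊆ connected p5Free
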